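{- Let $\mathrm{T}$ be a first-order theory, $\vdash$ a provability relation, and $S$ a set of closed terms. Assume that for every atomic formula $\varphi$, and every sentence $\bar\varphi$ obtained from $\varphi$ by substituting terms from $S$ for all of its free variables, we have $\mathrm{T}\vdash\bar\varphi$ or $\mathrm{T}\vdash\neg\bar\varphi$. Then for every sentence $\sigma$, $\mathrm{T}\vdash_S\sigma$ or $\mathrm{T}\vdash_S\neg\sigma$; i.e., the theory $[\mathrm{T},\vdash_S]$ is complete.
   Context: We work in first-order finitary logic $\mathscr L_{\omega,\omega}$ over a fixed vocabulary $\tau$. A provability relation $\vdash$ means the provability generated by the standard axioms and rules of classical first-order logic, or any stronger provability relation. For a set $S$ of closed terms of $\tau$, the $S$-rule is the schema of rules which, for each formula $\varphi$ with a single free variable $x$, infers $\forall x\,\varphi(x)$ from the set of premises $\{\varphi(t): t\in S\}$; $\vdash_S$ denotes the provability generated by $\vdash$ together with the $S$-rule. $[\mathrm{T},\vdash]$ denotes $\{\varphi:\mathrm{T}\vdash\varphi\}$; a theory is complete if for every sentence it contains the sentence or its negation. -}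

module Defs where

open import Level using (Level; 0ℓ)
open import Data.Nat using (ℕ; zero; suc)
open import Data.Fin using (Fin; zero; suc)
open import Data.Vec using (Vec; []; _∷_)
open import Data.Sum using (_⊎_)
open import Function using (_∘_)

-- A first-order vocabulary τ: function symbols (constants = arity 0)
-- and relation symbols, each with an arity.
record Vocabulary : Set₁ where
  field
    FunSym   : Set
    funArity : FunSym → ℕ
    RelSym   : Set
    relArity : RelSym → ℕ

module Lang (τ : Vocabulary) where
  open Vocabulary τ

  -- Terms with at most n free variables (de Bruijn indices Fin n).
  data Term (n : ℕ) : Set where
    var : Fin n → Term n
    fun : (f : FunSym) → Vec (Term n) (funArity f) → Term n

  mutual
    substT : ∀ {m n} → (Fin m → Term n) → Term m → Term n
    substT σ (var i)    = σ i
    substT σ (fun f ts) = fun f (substTs σ ts)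

    substTs : ∀ {m n k} → (Fin m → Term n) → Vec (Term m) k → Vec (Term n) k
    substTs σ []       = []
    substTs σ (t ∷ ts) = substT σ t ∷ substTs σ ts

  renT : ∀ {m n} → (Fin m → Fin n) → Term m → Term n
  renT ρ = substT (var ∘ ρ)

  infix  7 _≐_
  infixr 5 _⇒_
  infix  6 ~_
  data Formula (n : ℕ) : Set where
    rel  : (R : RelSym) → Vec (Term n) (relArity R) → Formula n
    _≐_  : Term n → Term n → Formula n
    ~_   : Formula n → Formula n
    _⇒_  : Formula n → Formula n → Formula n
    ∀'   : Formula (suc n) → Formula n

  liftσ : ∀ {m n} → (Fin m → Term n) → Fin (suc m) → Term (suc n)
  liftσ σ zero    = var zero
  liftσ σ (suc i) = renT suc (σ i)

  subst : ∀ {m n} → (Fin m → Term n) → Formula m → Formula n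
  subst σ (rel R ts) = rel R (substTs σ ts)
  subst σ (t ≐ u)    = substT σ t ≐ substT σ u
  subst σ (~ φ)      = ~ subst σ φ
  subst σ (φ ⇒ ψ)    = subst σ φ ⇒ subst σ ψ
  subst σ (∀' φ)     = ∀' (subst (liftσ σ) φ)

  single : ∀ {n} → Term n → Fin (suc n) → Term n
  single t zero    = t
  single t (suc i) = var i

  _[_] : ∀ {n} → Formula (suc n) → Term n → Formula n
  φ [ t ] = subst (single t) φ

  wk : ∀ {n} → Formula n → Formula (suc n)
  wk = subst (var ∘ suc)

  noVars : ∀ {n} → Fin 0 → Term n
  noVars ()

  closeWk : ∀ {n} → Formula 0 → Formula n
  closeWk = subst noVars

  Sentence : Set
  Sentence = Formula 0

  ClosedTerm : Set
  ClosedTerm = Term 0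

  data Atomic {n : ℕ} : Formula n → Set where
    atomRel : (R : RelSym) (ts : Vec (Term n) (relArity R)) → Atomic (rel R ts)
    atomEq  : (t u : Term n) → Atomic (t ≐ u)

  data _⊢FOL_ (Γ : Sentence → Set) : {n : ℕ} → Formula n → Set where
    hyp  : ∀ {n} {σ : Sentence} → Γ σ → Γ ⊢FOL closeWk {n} σ
    ax1  : ∀ {n} {φ ψ : Formula n} → Γ ⊢FOL (φ ⇒ ψ ⇒ φ)
    ax2  : ∀ {n} {φ ψ χ : Formula n} →
           Γ ⊢FOL ((φ ⇒ ψ ⇒ χ) ⇒ (φ ⇒ ψ) ⇒ φ ⇒ χ)
    ax3  : ∀ {n} {φ ψ : Formula n} → Γ ⊢FOL ((~ φ ⇒ ~ ψ) ⇒ ψ ⇒ φ)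
    ax4  : ∀ {n} {φ : Formula (suc n)} {t : Term n} → Γ ⊢FOL (∀' φ ⇒ φ [ t ])
    ax5  : ∀ {n} {φ : Formula n} {ψ : Formula (suc n)} →
           Γ ⊢FOL (∀' (wk φ ⇒ ψ) ⇒ φ ⇒ ∀' ψ)
    eqRefl : ∀ {n} {t : Term n} → Γ ⊢FOL (t ≐ t)
    eqSubst : ∀ {n} {t u : Term n} {φ : Formula (suc n)} →
           Γ ⊢FOL (t ≐ u ⇒ φ [ t ] ⇒ φ [ u ])
    mp   : ∀ {n} {φ ψ : Formula n} → Γ ⊢FOL φ → Γ ⊢FOL (φ ⇒ ψ) → Γ ⊢FOL ψ
    gen  : ∀ {n} {φ : Formula (suc n)} → Γ ⊢FOL φ → Γ ⊢FOL ∀' φ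

  ProvRel : Set₁
  ProvRel = (Sentence → Set) → Sentence → Set

  ExtendsFOL : ProvRel → Set₁
  ExtendsFOL _⊢_ = ∀ (Γ : Sentence → Set) (σ : Sentence) → Γ ⊢FOL σ → Γ ⊢ σ

  data _⊢[_,_]_ (T : Sentence → Set) (_⊢_ : ProvRel) (S : ClosedTerm → Set)
       : Sentence → Set₁ where
    axiom : ∀ {σ} → T σ → T ⊢[ _⊢_ , S ] σ
    byProv : ∀ {σ} (Γ : Sentence → Set) →
             (∀ ψ → Γ ψ → T ⊢[ _⊢_ , S ] ψ) → Γ ⊢ σ → T ⊢[ _⊢_ , S ] σ
    sRule : (φ : Formula 1) →
            (∀ (t : ClosedTerm) → S t → T ⊢[ _⊢_ , S ] (φ [ t ])) →
            T ⊢[ _⊢_ , S ] ∀' φ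

  Complete : ∀ {ℓ} → (Sentence → Set ℓ) → Set ℓ
  Complete Th = ∀ (σ : Sentence) → Th σ ⊎ Th (~ σ)

{-# OPTIONS --safe #-}
module Submission where

-- Induction on formulas, proving the claim simultaneously for all instances
-- of a formula by terms of S.  Atomic instances are decided by hypothesis;
-- negation and implication are decided by propositional reasoning from the
-- decisions of their parts.  For ∀x φ, classically either some S-instance
-- φ(t) is refuted, and then so is ∀x φ, or none is, and then by induction
-- every φ(t) is proved, so the S-rule proves ∀x φ.

open import Defs
open import Level using (suc; zero)
open import Data.Nat using (ℕ)
open import Data.Fin using (Fin)
open import Data.Sum using (_⊎_; inj₁; inj₂)
open import Data.Product using (∃; _×_; _,_)
open import Data.Empty using (⊥-elim)
open import Data.Vec using (Vec; []; _∷_)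
open import Function using (_∘_)
open import Relation.Nullary using (yes; no)
open import Relation.Binary.PropositionalEquality
  using (_≡_; refl; sym; trans; cong; cong₂)
import Relation.Binary.PropositionalEquality as Eq
open import Axiom.ExcludedMiddle using (ExcludedMiddle)

module Substitution (τ : Vocabulary) where
  open Lang τ

  mutual
    substT-cong : ∀ {m n} {σ σ′ : Fin m → Term n} → (∀ i → σ i ≡ σ′ i) →
                  (u : Term m) → substT σ u ≡ substT σ′ u
    substT-cong eq (var i)    = eq i
    substT-cong eq (fun f ts) = cong (fun f) (substTs-cong eq ts)

    substTs-cong : ∀ {m n k} {σ σ′ : Fin m → Term n} → (∀ i → σ i ≡ σ′ i) →
                   (ts : Vec (Term m) k) → substTs σ ts ≡ substTs σ′ ts
    substTs-cong eq []       = refl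
    substTs-cong eq (t ∷ ts) = cong₂ _∷_ (substT-cong eq t) (substTs-cong eq ts)

  mutual
    substT-id : ∀ {m} {σ : Fin m → Term m} → (∀ i → σ i ≡ var i) →
                (u : Term m) → substT σ u ≡ u
    substT-id eq (var i)    = eq i
    substT-id eq (fun f ts) = cong (fun f) (substTs-id eq ts)

    substTs-id : ∀ {m k} {σ : Fin m → Term m} → (∀ i → σ i ≡ var i) →
                 (ts : Vec (Term m) k) → substTs σ ts ≡ ts
    substTs-id eq []       = refl
    substTs-id eq (t ∷ ts) = cong₂ _∷_ (substT-id eq t) (substTs-id eq ts)

  mutual
    substT-substT : ∀ {l m n} (ρ : Fin m → Term n) (σ : Fin l → Term m) (u : Term l) →
                    substT ρ (substT σ u) ≡ substT (substT ρ ∘ σ) u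
    substT-substT ρ σ (var i)    = refl
    substT-substT ρ σ (fun f ts) = cong (fun f) (substTs-substTs ρ σ ts)

    substTs-substTs : ∀ {l m n k} (ρ : Fin m → Term n) (σ : Fin l → Term m)
                      (ts : Vec (Term l) k) →
                      substTs ρ (substTs σ ts) ≡ substTs (substT ρ ∘ σ) ts
    substTs-substTs ρ σ []       = refl
    substTs-substTs ρ σ (t ∷ ts) =
      cong₂ _∷_ (substT-substT ρ σ t) (substTs-substTs ρ σ ts)

  liftσ-cong : ∀ {m n} {σ σ′ : Fin m → Term n} → (∀ i → σ i ≡ σ′ i) →
               ∀ i → liftσ σ i ≡ liftσ σ′ i
  liftσ-cong eq Fin.zero    = refl
  liftσ-cong eq (Fin.suc i) = cong (renT Fin.suc) (eq i)

  liftσ-id : ∀ {m} {σ : Fin m → Term m} → (∀ i → σ i ≡ var i) →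
             ∀ i → liftσ σ i ≡ var i
  liftσ-id eq Fin.zero    = refl
  liftσ-id eq (Fin.suc i) = cong (renT Fin.suc) (eq i)

  liftσ-substT : ∀ {l m n} (ρ : Fin m → Term n) (σ : Fin l → Term m) →
                 ∀ i → substT (liftσ ρ) (liftσ σ i) ≡ liftσ (substT ρ ∘ σ) i
  liftσ-substT ρ σ Fin.zero    = refl
  liftσ-substT ρ σ (Fin.suc i) =
    trans (substT-substT (liftσ ρ) (var ∘ Fin.suc) (σ i))
          (sym (substT-substT (var ∘ Fin.suc) ρ (σ i)))

  subst-cong : ∀ {m n} {σ σ′ : Fin m → Term n} → (∀ i → σ i ≡ σ′ i) →
               (φ : Formula m) → subst σ φ ≡ subst σ′ φ
  subst-cong eq (rel R ts) = cong (rel R) (substTs-cong eq ts)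
  subst-cong eq (t ≐ u)    = cong₂ _≐_ (substT-cong eq t) (substT-cong eq u)
  subst-cong eq (~ φ)      = cong ~_ (subst-cong eq φ)
  subst-cong eq (φ ⇒ ψ)    = cong₂ _⇒_ (subst-cong eq φ) (subst-cong eq ψ)
  subst-cong eq (∀' φ)     = cong ∀' (subst-cong (liftσ-cong eq) φ)

  subst-id : ∀ {m} {σ : Fin m → Term m} → (∀ i → σ i ≡ var i) →
             (φ : Formula m) → subst σ φ ≡ φ
  subst-id eq (rel R ts) = cong (rel R) (substTs-id eq ts)
  subst-id eq (t ≐ u)    = cong₂ _≐_ (substT-id eq t) (substT-id eq u)
  subst-id eq (~ φ)      = cong ~_ (subst-id eq φ)
  subst-id eq (φ ⇒ ψ)    = cong₂ _⇒_ (subst-id eq φ) (subst-id eq ψ)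
  subst-id eq (∀' φ)     = cong ∀' (subst-id (liftσ-id eq) φ)

  subst-subst : ∀ {l m n} (ρ : Fin m → Term n) (σ : Fin l → Term m) (φ : Formula l) →
                subst ρ (subst σ φ) ≡ subst (substT ρ ∘ σ) φ
  subst-subst ρ σ (rel R ts) = cong (rel R) (substTs-substTs ρ σ ts)
  subst-subst ρ σ (t ≐ u)    = cong₂ _≐_ (substT-substT ρ σ t) (substT-substT ρ σ u)
  subst-subst ρ σ (~ φ)      = cong ~_ (subst-subst ρ σ φ)
  subst-subst ρ σ (φ ⇒ ψ)    = cong₂ _⇒_ (subst-subst ρ σ φ) (subst-subst ρ σ ψ)
  subst-subst ρ σ (∀' φ)     =
    cong ∀' (trans (subst-subst (liftσ ρ) (liftσ σ) φ) (subst-cong (liftσ-substT ρ σ) φ))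

  closeWk-sentence : (σ : Sentence) → closeWk σ ≡ σ
  closeWk-sentence = subst-id (λ ())

  consₛ : ∀ {n} → ClosedTerm → (Fin n → ClosedTerm) → Fin (ℕ.suc n) → ClosedTerm
  consₛ t s Fin.zero    = t
  consₛ t s (Fin.suc i) = s i

  subst-liftσ-[] : ∀ {n} (s : Fin n → ClosedTerm) (t : ClosedTerm) (φ : Formula (ℕ.suc n)) →
                   subst (liftσ s) φ [ t ] ≡ subst (consₛ t s) φ
  subst-liftσ-[] s t φ = trans (subst-subst (single t) (liftσ s) φ) (subst-cong pointwise φ)
    where
    pointwise : ∀ i → substT (single t) (liftσ s i) ≡ consₛ t s i
    pointwise Fin.zero    = refl
    pointwise (Fin.suc i) =
      trans (substT-substT (single t) (var ∘ Fin.suc) (s i)) (substT-id (λ _ → refl) (s i))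

module HilbertCalculus (τ : Vocabulary) {Γ : Lang.Sentence τ → Set} where
  open Lang τ

  ⇒-refl : ∀ {n} {A : Formula n} → Γ ⊢FOL (A ⇒ A)
  ⇒-refl {A = A} = mp (ax1 {ψ = A}) (mp (ax1 {ψ = A ⇒ A}) ax2)

  ⇒-trans : ∀ {n} {A B C : Formula n} → Γ ⊢FOL (A ⇒ B) → Γ ⊢FOL (B ⇒ C) → Γ ⊢FOL (A ⇒ C)
  ⇒-trans ab bc = mp ab (mp (mp bc ax1) ax2)

  ⇒-contract : ∀ {n} {A B : Formula n} → Γ ⊢FOL (A ⇒ A ⇒ B) → Γ ⊢FOL (A ⇒ B)
  ⇒-contract aab = mp ⇒-refl (mp aab ax2)

  ¬¬-elim : ∀ {n} {A : Formula n} → Γ ⊢FOL (~ ~ A ⇒ A)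
  ¬¬-elim {A = A} = ⇒-contract (⇒-trans (ax1 {ψ = ~ ~ ~ ~ A}) (⇒-trans ax3 ax3))

  ¬¬-intro : ∀ {n} {A : Formula n} → Γ ⊢FOL (A ⇒ ~ ~ A)
  ¬¬-intro = mp ¬¬-elim ax3

  contraposition : ∀ {n} {A B : Formula n} → Γ ⊢FOL (A ⇒ B) → Γ ⊢FOL (~ B ⇒ ~ A)
  contraposition ab = mp (⇒-trans ¬¬-elim (⇒-trans ab ¬¬-intro)) ax3

  ex-falso : ∀ {n} {A B : Formula n} → Γ ⊢FOL (~ A ⇒ A ⇒ B)
  ex-falso = ⇒-trans ax1 ax3

  modus-ponens : ∀ {n} {A B : Formula n} → Γ ⊢FOL (A ⇒ (A ⇒ B) ⇒ B)
  modus-ponens = ⇒-trans ax1 (mp ⇒-refl ax2)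

  assumption : ∀ {σ} → Γ σ → Γ ⊢FOL σ
  assumption {σ} γ = Eq.subst (Γ ⊢FOL_) (Substitution.closeWk-sentence τ σ) (hyp γ)

module SProvability (τ : Vocabulary) (T : Lang.Sentence τ → Set) (_⊢_ : Lang.ProvRel τ)
                    (extendsFOL : Lang.ExtendsFOL τ _⊢_) (S : Lang.ClosedTerm τ → Set) where
  open Lang τ
  open HilbertCalculus τ

  infix 4 ⊢ₛ_
  ⊢ₛ_ : Sentence → Set₁
  ⊢ₛ σ = T ⊢[ _⊢_ , S ] σ

  Decided : Sentence → Set₁
  Decided σ = ⊢ₛ σ ⊎ ⊢ₛ ~ σ

  ⊢-⇒-⊢ₛ : ∀ {σ} → T ⊢ σ → ⊢ₛ σ
  ⊢-⇒-⊢ₛ = byProv T (λ _ → axiom)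

  ⊢ₛ-infer₁ : ∀ {A C} → ⊢ₛ A → (_≡ A) ⊢FOL C → ⊢ₛ C
  ⊢ₛ-infer₁ {A} {C} ⊢A d = byProv (_≡ A) (λ { _ refl → ⊢A }) (extendsFOL _ C d)

  ⊢ₛ-infer₂ : ∀ {A B C} → ⊢ₛ A → ⊢ₛ B → (λ σ → σ ≡ A ⊎ σ ≡ B) ⊢FOL C → ⊢ₛ C
  ⊢ₛ-infer₂ {A} {B} {C} ⊢A ⊢B d = byProv _ premise (extendsFOL _ C d)
    where
    premise : ∀ σ → σ ≡ A ⊎ σ ≡ B → ⊢ₛ σ
    premise _ (inj₁ refl) = ⊢A
    premise _ (inj₂ refl) = ⊢B

  decided-~ : ∀ {A} → Decided A → Decided (~ A)
  decided-~ (inj₁ ⊢A)  = inj₂ (⊢ₛ-infer₁ ⊢A (mp (assumption refl) ¬¬-intro))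
  decided-~ (inj₂ ⊢¬A) = inj₁ ⊢¬A

  decided-⇒ : ∀ {A B} → Decided A → Decided B → Decided (A ⇒ B)
  decided-⇒ _          (inj₁ ⊢B)  = inj₁ (⊢ₛ-infer₁ ⊢B (mp (assumption refl) ax1))
  decided-⇒ (inj₂ ⊢¬A) (inj₂ _)   = inj₁ (⊢ₛ-infer₁ ⊢¬A (mp (assumption refl) ex-falso))
  decided-⇒ (inj₁ ⊢A)  (inj₂ ⊢¬B) = inj₂ (⊢ₛ-infer₂ ⊢A ⊢¬B
    (mp (assumption (inj₂ refl)) (contraposition (mp (assumption (inj₁ refl)) modus-ponens))))

  decided-∀ : ExcludedMiddle (suc zero) → (φ : Formula 1) →
              (∀ t → S t → Decided (φ [ t ])) → Decided (∀' φ)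
  decided-∀ em φ decided with em {∃ λ t → S t × ⊢ₛ ~ φ [ t ]}
  ... | yes (t , _ , ⊢¬φt) = inj₂ (⊢ₛ-infer₁ ⊢¬φt (mp (assumption refl) (contraposition ax4)))
  ... | no no-counterexample = inj₁ (sRule φ instance-provable)
    where
    instance-provable : ∀ t → S t → ⊢ₛ φ [ t ]
    instance-provable t St with decided t St
    ... | inj₁ ⊢φt  = ⊢φt
    ... | inj₂ ⊢¬φt = ⊥-elim (no-counterexample (t , St , ⊢¬φt))

theorem1 : ExcludedMiddle (suc zero) →
    (τ : Vocabulary) → let open Lang τ in
    (T : Sentence → Set) (_⊢_ : ProvRel) → ExtendsFOL _⊢_ →
    (S : ClosedTerm → Set) →
    (∀ (n : ℕ) (φ : Formula n) → Atomic φ →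
    (s : Fin n → ClosedTerm) → (∀ i → S (s i)) →
    (T ⊢ subst s φ) ⊎ (T ⊢ (~ subst s φ))) →
    Complete (λ σ → T ⊢[ _⊢_ , S ] σ)
theorem1 em τ T _⊢_ extendsFOL S atomic-decided σ =
  Eq.subst Decided (closeWk-sentence σ) (instances-decided σ noVars (λ ()))
  where
  open Lang τ
  open Substitution τ
  open SProvability τ T _⊢_ extendsFOL S

  atomic-instance-decided : ∀ {n} (φ : Formula n) → Atomic φ →
    (s : Fin n → ClosedTerm) → (∀ i → S (s i)) → Decided (subst s φ)
  atomic-instance-decided φ atomic s s∈S with atomic-decided _ φ atomic s s∈S
  ... | inj₁ ⊢φs  = inj₁ (⊢-⇒-⊢ₛ ⊢φs)
  ... | inj₂ ⊢¬φs = inj₂ (⊢-⇒-⊢ₛ ⊢¬φs)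

  instances-decided : ∀ {n} (φ : Formula n) (s : Fin n → ClosedTerm) → (∀ i → S (s i)) →
                      Decided (subst s φ)
  instances-decided (rel R ts) = atomic-instance-decided _ (atomRel R ts)
  instances-decided (t ≐ u)    = atomic-instance-decided _ (atomEq t u)
  instances-decided (~ φ) s s∈S = decided-~ (instances-decided φ s s∈S)
  instances-decided (φ ⇒ ψ) s s∈S =
    decided-⇒ (instances-decided φ s s∈S) (instances-decided ψ s s∈S)
  instances-decided (∀' φ) s s∈S = decided-∀ em (subst (liftσ s) φ) λ t t∈S →
    Eq.subst Decided (sym (subst-liftσ-[] s t φ))
      (instances-decided φ (consₛ t s) λ { Fin.zero → t∈S ; (Fin.suc i) → s∈S i })
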